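{- Let $Q=(q_n)_{n\ge1}$ be a basic sequence that is infinite in limit, and suppose there exist constants $M$ and $t$ such that $\nu_{i+1}-\nu_i\le Mi$ for all $i>t$. Then $l_i\le\lceil M+1\rceil$ for all $i>t$.
   Context: A basic sequence is a sequence $Q=(q_n)_{n\ge1}$ of integers with $q_n\ge 2$; it is infinite in limit if $q_n\to\infty$. For each positive integer $j$ let $\nu_j=\min\{N: q_m\ge 2j^2 \text{ for all } m\ge N\}$. Let $l_1=\max(\nu_2-1,1)$ and, recursively for $i\ge2$, let $l_i$ be the smallest positive integer $k$ with $l_1+2l_2+\cdots+(i-1)l_{i-1}+ik\ge \nu_{i+1}-1$.
   Formalization: The constant M in the bound on $\nu_{i+1}-\nu_i$ ranges over the rationals. -}

module Defs where

open import Data.Nat using (ℕ; zero; suc; _+_; _*_; _∸_; _⊔_; _≤_; _<_)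
open import Data.Product using (Σ; ∃; _×_)
open import Relation.Binary.PropositionalEquality using (_≡_)

-- A sequence (q_n)_{n ≥ 1} is modelled as q : ℕ → ℕ; the value q 0 is ignored.

IsBasic : (ℕ → ℕ) → Set
IsBasic q = ∀ n → 1 ≤ n → 2 ≤ q n

InfiniteInLimit : (ℕ → ℕ) → Set
InfiniteInLimit q = ∀ B → ∃ λ N → ∀ m → N ≤ m → B ≤ q m

AllFrom : (ℕ → ℕ) → ℕ → ℕ → Set
AllFrom q b N = ∀ m → N ≤ m → 1 ≤ m → b ≤ q m

IsNu : (ℕ → ℕ) → ℕ → ℕ → Set
IsNu q j n = 1 ≤ n × AllFrom q (2 * (j * j)) n
           × (∀ N → 1 ≤ N → AllFrom q (2 * (j * j)) N → n ≤ N)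

wsum : (ℕ → ℕ) → ℕ → ℕ
wsum l zero = 0
wsum l (suc i) = wsum l i + suc i * l (suc i)

IsL : (ℕ → ℕ) → (ℕ → ℕ) → Set
IsL ν l =
  (l 1 ≡ (ν 2 ∸ 1) ⊔ 1) ×
  (∀ i → 2 ≤ i →
     1 ≤ l i
     × ν (suc i) ∸ 1 ≤ wsum l (i ∸ 1) + i * l i
     × (∀ k → 1 ≤ k → ν (suc i) ∸ 1 ≤ wsum l (i ∸ 1) + i * k → l i ≤ k))

-- Write c = ⌈M + 1⌉.  The proof has an arithmetic half and a combinatorial half.
--
-- Since M + 1 ≤ c and i ≥ 0, the
-- hypothesis ν_{i+1} - ν_i ≤ M i gives  ν_{i+1} + i ≤ c i + ν_i.  This is done by
-- clearing the denominator d of M = n/d:  (ν_{i+1} - ν_i) d ≤ n i  and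
-- n + d ≤ c d  combine to the claim after cancelling d.
--
-- Combinatorial half (naturals).  ν is monotone (the thresholds 2 j² grow), so
-- ν_{i+1} + i ≤ c i + ν_i forces c ≥ 1; write c = k.  The weighted sums satisfy
-- l_1 + 2 l_2 + ... + (i-1) l_{i-1} ≥ ν_i - 1, hence
--   ν_{i+1} - 1 ≤ ν_i - 1 + i k ≤ l_1 + ... + (i-1) l_{i-1} + i k,
-- so k is admissible in the definition of l_i and the minimality of l_i gives
-- l_i ≤ k.  For i = 1 one uses ν_1 = 1 and l_1 = max(ν_2 - 1, 1) directly.
module Submission where

open import Defs
open import Data.Nat using (ℕ; suc; _<_; _≤_)
open import Data.Integer using (ℤ; +_; _-_)
open import Data.Rational using (ℚ; _/_; _*_; _+_; 1ℚ; ceiling)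
open import Data.Rational as Q using ()
open import Data.Integer as Z using ()

open import Data.Nat as N using (zero; z≤n; s≤s; _⊔_; _∸_)
open import Data.Integer using (-[1+_]; 0ℤ)
open import Data.Sign as Sign using ()
import Data.Nat.Properties as NP
import Data.Integer.Properties as ZP
import Data.Integer.GCD as ZG
import Data.Integer.DivMod as ZD
open import Data.Rational using (mkℚ; floor; ↥_; ↧_; toℚᵘ)
import Data.Rational.Properties as QP
import Data.Rational.Unnormalised as U
import Data.Rational.Unnormalised.Properties as UP
import Data.Nat.Tactic.RingSolver as NatSolver
open import Data.Integer.Tactic.RingSolver using (solve-∀)
open import Data.Product using (proj₁; proj₂)
open import Data.Empty using (⊥-elim)
open import Relation.Nullary using (¬_)
open import Relation.Binary.PropositionalEquality

↥-/1 : ∀ a → ↥ (a / 1) ≡ a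
↥-/1 a = trans (sym (ZP.*-identityʳ _))
  (trans (cong (↥ (a / 1) Z.*_) (sym (ZG.gcd-zeroʳ a))) (QP.↥-/ a 1))

↧-/1 : ∀ a → ↧ (a / 1) ≡ + 1
↧-/1 a = trans (sym (ZP.*-identityʳ _))
  (trans (cong (↧ (a / 1) Z.*_) (sym (ZG.gcd-zeroʳ a))) (QP.↧-/ a 1))

-- ⌈p⌉ is an upper bound of p, in cross-multiplied form:  ↥ p ≤ ⌈p⌉ ↧ p.
-- It follows from the lower bound ⌊-p⌋ ↧ p ≤ -↥ p, since ⌈p⌉ = -⌊-p⌋.

floor-lower : ∀ p → floor p Z.* ↧ p Z.≤ ↥ p
floor-lower (mkℚ n d _) = ZD.[n/d]*d≤n n (+ suc d)

ceiling-upper : ∀ p → ↥ p Z.≤ ceiling p Z.* ↧ p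
ceiling-upper p@(mkℚ _ _ _) =
  subst₂ Z._≤_ (ZP.neg-involutive (↥ p)) (ZP.neg-distribˡ-* (floor (Q.- p)) (↧ p))
    (ZP.neg-mono-≤ lower-of-neg)
  where
  lower-of-neg : floor (Q.- p) Z.* ↧ p Z.≤ Z.- ↥ p
  lower-of-neg = subst₂ (λ u v → floor (Q.- p) Z.* u Z.≤ v) (QP.↧-neg p) (QP.↥-neg p)
    (floor-lower (Q.- p))

cross-≤′ : ∀ (A B M : ℚ) a i → ↥ A ≡ a → ↧ A ≡ + 1 → ↥ B ≡ i → ↧ B ≡ + 1 →
  toℚᵘ A U.≤ toℚᵘ M U.* toℚᵘ B → a Z.* ↧ M Z.≤ ↥ M Z.* i
cross-≤′ (mkℚ a _ _) (mkℚ i _ _) (mkℚ n dm _) .a .i refl refl refl refl (U.*≤* h) =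
  subst₂ Z._≤_ (cong (λ k → a Z.* + suc k) (NP.*-identityʳ dm)) (ZP.*-identityʳ (n Z.* i)) h

cross-≤ : ∀ a i M → (a / 1) Q.≤ M * (i / 1) → a Z.* ↧ M Z.≤ ↥ M Z.* i
cross-≤ a i M h = cross-≤′ (a / 1) (i / 1) M a i (↥-/1 a) (↧-/1 a) (↥-/1 i) (↧-/1 i)
  (UP.≤-respʳ-≃ (QP.toℚᵘ-homo-* M (i / 1)) (QP.toℚᵘ-mono-≤ h))

succ-below-ceiling′ : ∀ (P M : ℚ) c → ↥ P Z.≤ c Z.* ↧ P → toℚᵘ P U.≃ toℚᵘ M U.+ toℚᵘ 1ℚ →
  ↥ M Z.+ ↧ M Z.≤ c Z.* ↧ M
succ-below-ceiling′ (mkℚ p dp _) (mkℚ n dm _) c h (U.*≡* P≃M+1) =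
  ZP.*-cancelʳ-≤-pos (n Z.+ d) (c Z.* d) D
    (subst₂ Z._≤_ cleared (reorder c D d) (ZP.*-monoʳ-≤-nonNeg d h))
  where
  d D : ℤ
  d = + suc dm
  D = + suc dp
  normalise : ∀ n d D → (n Z.* + 1 Z.+ + 1 Z.* d) Z.* D ≡ (n Z.+ d) Z.* D
  normalise = solve-∀
  reorder : ∀ c D d → c Z.* D Z.* d ≡ c Z.* d Z.* D
  reorder = solve-∀
  cleared : p Z.* d ≡ (n Z.+ d) Z.* D
  cleared = trans (cong (λ k → p Z.* + suc k) (sym (NP.*-identityʳ dm)))
                  (trans P≃M+1 (normalise n d D))

succ-below-ceiling : ∀ M → ↥ M Z.+ ↧ M Z.≤ ceiling (M + 1ℚ) Z.* ↧ M
succ-below-ceiling M = succ-below-ceiling′ (M + 1ℚ) M (ceiling (M + 1ℚ))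
  (ceiling-upper (M + 1ℚ)) (QP.toℚᵘ-homo-+ M 1ℚ)

combine : ∀ a n c dm i → a Z.* + suc dm Z.≤ n Z.* + i → n Z.+ + suc dm Z.≤ c Z.* + suc dm →
  a Z.+ + i Z.≤ c Z.* + i
combine a n c dm i a≤Mi M+1≤c = ZP.*-cancelʳ-≤-pos _ _ d (begin
    (a Z.+ + i) Z.* d        ≡⟨ distrib a (+ i) d ⟩
    a Z.* d Z.+ + i Z.* d    ≤⟨ ZP.+-monoˡ-≤ (+ i Z.* d) a≤Mi ⟩
    n Z.* + i Z.+ + i Z.* d  ≡⟨ collect n (+ i) d ⟩
    (n Z.+ d) Z.* + i        ≤⟨ ZP.*-monoʳ-≤-nonNeg (+ i) M+1≤c ⟩
    c Z.* d Z.* + i          ≡⟨ swap c d (+ i) ⟩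
    c Z.* + i Z.* d ∎)
  where
  open ZP.≤-Reasoning
  d : ℤ
  d = + suc dm
  distrib : ∀ a i d → (a Z.+ i) Z.* d ≡ a Z.* d Z.+ i Z.* d
  distrib = solve-∀
  collect : ∀ n i d → n Z.* i Z.+ i Z.* d ≡ (n Z.+ d) Z.* i
  collect = solve-∀
  swap : ∀ c d i → c Z.* d Z.* i ≡ c Z.* i Z.* d
  swap = solve-∀

slope-bound : ∀ (M : ℚ) (x y i : ℕ) → ((+ x - + y) / 1) Q.≤ M * ((+ i) / 1) →
  + x Z.+ + i Z.≤ ceiling (M + 1ℚ) Z.* + i Z.+ + y
slope-bound M@(mkℚ n dm _) x y i h =
  subst (Z._≤ _) (cancel-y (+ x) (+ y) (+ i))
    (ZP.+-monoˡ-≤ (+ y) (combine (+ x - + y) n (ceiling (M + 1ℚ)) dm i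
      (cross-≤ (+ x - + y) (+ i) M h) (succ-below-ceiling M)))
  where
  cancel-y : ∀ x y i → (x - y Z.+ i) Z.+ y ≡ x Z.+ i
  cancel-y = solve-∀

-◃-nonPos : ∀ n → Sign.- Z.◃ n Z.≤ 0ℤ
-◃-nonPos zero    = Z.+≤+ z≤n
-◃-nonPos (suc n) = Z.-≤+

slope-step : ∀ a b i k → 1 ≤ i → a N.+ i ≤ k N.* i N.+ b → a ≤ (b ∸ 1) N.+ i N.* k
slope-step a b i k 1≤i h = NP.+-cancelʳ-≤ i a ((b ∸ 1) N.+ i N.* k) (begin
  a N.+ i                     ≤⟨ h ⟩
  k N.* i N.+ b               ≤⟨ NP.+-monoʳ-≤ (k N.* i) (NP.m≤n+m∸n b 1) ⟩
  k N.* i N.+ (1 N.+ (b ∸ 1)) ≤⟨ NP.+-monoʳ-≤ (k N.* i) (NP.+-monoˡ-≤ (b ∸ 1) 1≤i) ⟩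
  k N.* i N.+ (i N.+ (b ∸ 1)) ≡⟨ regroup k i (b ∸ 1) ⟩
  (b ∸ 1) N.+ i N.* k N.+ i ∎)
  where
  open NP.≤-Reasoning
  regroup : ∀ k i c → k N.* i N.+ (i N.+ c) ≡ c N.+ i N.* k N.+ i
  regroup = NatSolver.solve-∀

module Thresholds (q : ℕ → ℕ) (basic : IsBasic q) (ν : ℕ → ℕ)
                  (isNu : ∀ j → 1 ≤ j → IsNu q j (ν j)) where

  -- ν_1 = 1, because every term of a basic sequence is at least 2 = 2·1².
  ν-one : ν 1 ≡ 1
  ν-one = NP.≤-antisym (proj₂ (proj₂ (isNu 1 (s≤s z≤n))) 1 (s≤s z≤n) (λ m _ m≥1 → basic m m≥1))
                       (proj₁ (isNu 1 (s≤s z≤n)))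

  -- ν is monotone: from ν_{i+1} on, q_m ≥ 2(i+1)² ≥ 2i², so ν_i ≤ ν_{i+1} by minimality.
  ν-mono : ∀ i → 1 ≤ i → ν i ≤ ν (suc i)
  ν-mono i 1≤i = proj₂ (proj₂ (isNu i 1≤i)) (ν (suc i)) (proj₁ (isNu (suc i) (s≤s z≤n)))
    (λ m from m≥1 → NP.≤-trans threshold (proj₁ (proj₂ (isNu (suc i) (s≤s z≤n))) m from m≥1))
    where
    threshold : 2 N.* (i N.* i) ≤ 2 N.* (suc i N.* suc i)
    threshold = NP.*-monoʳ-≤ 2 (NP.*-mono-≤ (NP.n≤1+n i) (NP.n≤1+n i))

  ν-no-drop : ∀ i → 1 ≤ i → ¬ (ν (suc i) N.+ i ≤ ν i)
  ν-no-drop i 1≤i = NP.<⇒≱ (NP.≤-<-trans (ν-mono i 1≤i) (NP.m<m+n (ν (suc i)) 1≤i))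

  module WeightedSums (l : ℕ → ℕ) (isL : IsL ν l) where

    wsum-reaches : ∀ j → 1 ≤ j → ν (suc j) ∸ 1 ≤ wsum l j
    wsum-reaches (suc zero) _ = begin
      ν 2 ∸ 1          ≤⟨ NP.m≤m⊔n (ν 2 ∸ 1) 1 ⟩
      (ν 2 ∸ 1) ⊔ 1    ≡⟨ sym (proj₁ isL) ⟩
      l 1              ≡⟨ sym (NP.*-identityˡ (l 1)) ⟩
      wsum l 1 ∎
      where open NP.≤-Reasoning
    wsum-reaches (suc (suc j)) _ = proj₁ (proj₂ (proj₂ isL (suc (suc j)) (s≤s (s≤s z≤n))))

    l-bound : ∀ i k → 1 ≤ i → ν (suc i) N.+ i ≤ k N.* i N.+ ν i → l i ≤ k
    l-bound i zero 1≤i h = ⊥-elim (ν-no-drop i 1≤i h)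
    l-bound (suc zero) k@(suc _) 1≤i h rewrite proj₁ isL =
      NP.⊔-lub (NP.≤-trans (NP.m∸n≤m (ν 2) 1) ν₂≤k) (s≤s z≤n)
      where
      open NP.≤-Reasoning
      ν₂≤k : ν 2 ≤ k
      ν₂≤k = begin
        ν 2                   ≤⟨ slope-step (ν 2) (ν 1) 1 k 1≤i h ⟩
        (ν 1 ∸ 1) N.+ 1 N.* k ≡⟨ cong (λ v → (v ∸ 1) N.+ 1 N.* k) ν-one ⟩
        1 N.* k               ≡⟨ NP.*-identityˡ k ⟩
        k ∎
    l-bound i@(suc (suc j)) k@(suc _) 1≤i h =
      proj₂ (proj₂ (proj₂ isL i (s≤s (s≤s z≤n)))) k (s≤s z≤n) (begin
        ν (suc i) ∸ 1              ≤⟨ NP.m∸n≤m (ν (suc i)) 1 ⟩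
        ν (suc i)                  ≤⟨ slope-step (ν (suc i)) (ν i) i k 1≤i h ⟩
        (ν i ∸ 1) N.+ i N.* k      ≤⟨ NP.+-monoˡ-≤ (i N.* k) (wsum-reaches (suc j) (s≤s z≤n)) ⟩
        wsum l (suc j) N.+ i N.* k ∎)
      where open NP.≤-Reasoning

    l-bound-ℤ : ∀ i c → 1 ≤ i → + ν (suc i) Z.+ + i Z.≤ c Z.* + i Z.+ + ν i → + l i Z.≤ c
    l-bound-ℤ i (+ k) 1≤i h =
      Z.+≤+ (l-bound i k 1≤i (ZP.drop‿+≤+ (subst (λ v → _ Z.≤ v Z.+ + ν i) (sym (ZP.pos-* k i)) h)))
    l-bound-ℤ i -[1+ m ] 1≤i h =
      ⊥-elim (ν-no-drop i 1≤i (ZP.drop‿+≤+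
        (ZP.≤-trans h (ZP.+-monoˡ-≤ (+ ν i) (-◃-nonPos (suc m N.* i))))))

mainTheorem16 : (q : ℕ → ℕ) → IsBasic q → InfiniteInLimit q →
    (ν : ℕ → ℕ) → (∀ j → 1 ≤ j → IsNu q j (ν j)) →
    (l : ℕ → ℕ) → IsL ν l →
    (M : ℚ) (t : ℕ) →
    (∀ i → t < i → 1 ≤ i → ((+ ν (suc i) - + ν i) / 1) Q.≤ M * ((+ i) / 1)) →
    ∀ i → t < i → 1 ≤ i → (+ l i) Z.≤ ceiling (M + 1ℚ)
mainTheorem16 q basic _ ν isNu l isL M t slopes i t<i 1≤i =
  l-bound-ℤ i (ceiling (M + 1ℚ)) 1≤i (slope-bound M (ν (suc i)) (ν i) i (slopes i t<i 1≤i))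
  where open Thresholds.WeightedSums q basic ν isNu l isL
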